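{- Every boolean function in the class $\mathcal{G}$ is convenient.
   Context: $B=\{0,1\}$. $\mathcal{G}$ is the set of boolean functions obtained from $n$-input OR ($x_1+\cdots+x_n$) or $n$-input XOR ($x_1\oplus\cdots\oplus x_n$), for any $n\ge1$, by complementing any number of inputs and/or the output. A transient is a nonempty word $\mathbf{t}=t_1\cdots t_m$ over $B$ with consecutive letters different; $\alpha(\mathbf{t})=t_1$, $\omega(\mathbf{t})=t_m$, $\Delta(\mathbf{t})=m-1$; the contraction of a nonempty binary word deletes every letter equal to its predecessor. A transient vector $\mathbf{x}=(\mathbf{x}_1,\ldots,\mathbf{x}_n)$ has $\Delta(\mathbf{x})=\sum_i\Delta(\mathbf{x}_i)$; it is proper if every $\Delta(\mathbf{x}_i)\ge1$. For proper $\mathbf{t}=t_1\cdots t_m$ the characteristic transient is $\tilde{\mathbf{t}}=t_1t_2$ if $m$ is even and $t_1t_2t_3$ if $m$ is odd; for proper $\mathbf{x}$, $\tilde{\mathbf{x}}=(\tilde{\mathbf{x}}_1,\ldots,\tilde{\mathbf{x}}_n)$. Extension: for $f:B^n\to B$, $D_f(\mathbf{x})$ has as vertices the vectors of nonempty prefixes of the components of $\mathbf{x}$, with arcs appending one letter to exactly one component, and vertex label $\lambda(\mathbf{v})=f(\omega(\mathbf{v}))$ ($\omega$ componentwise). $\mathbf{f}(\mathbf{x})$ is the longest contraction of $\lambda(\mathbf{v}^1)\cdots\lambda(\mathbf{v}^r)$ over directed paths $\mathbf{v}^1,\ldots,\mathbf{v}^r$ from the vector of first letters of $\mathbf{x}$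 to $\mathbf{x}$. Cost: $c_f(\mathbf{x})=\Delta(\mathbf{x})-\Delta(\mathbf{f}(\mathbf{x}))$. A function $f:B^n\to B$ depends on its $k$-th argument if changing only $x_k$ changes $f$ for some assignment. $f$ is convenient if it depends on all its variables and $c_f(\mathbf{x})=c_f(\tilde{\mathbf{x}})$ for every proper transient vector $\mathbf{x}$. -}

module Defs where

open import Data.Bool using (Bool; true; false; not; _xor_; _∨_; if_then_else_)
open import Data.Nat using (ℕ; zero; suc; _∸_; _≤_; _%_; _+_)
open import Data.Integer as ℤ using (ℤ; +_; _-_)
open import Data.List using (List; []; _∷_; [_]; _++_; length; map; take)
open import Data.Vec as V using (Vec; lookup; _[_]≔_)
open import Data.Vec.Relation.Unary.All using (All)
open import Data.Fin using (Fin)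
open import Data.Product using (Σ; ∃; _×_; _,_)
open import Relation.Binary.PropositionalEquality using (_≡_; _≢_)

data Alternating : List Bool → Set where
  alt[] : Alternating []
  alt1  : ∀ {a} → Alternating (a ∷ [])
  alt∷  : ∀ {a b w} → a ≢ b → Alternating (b ∷ w) → Alternating (a ∷ b ∷ w)

data NonEmpty : List Bool → Set where
  ne : ∀ {a w} → NonEmpty (a ∷ w)

Transient : List Bool → Set
Transient w = NonEmpty w × Alternating w

Δ : List Bool → ℕ
Δ w = length w ∸ 1

-- ω : last letter (only used on nonempty words)
ω : List Bool → Bool
ω []          = false
ω (a ∷ [])    = a
ω (a ∷ b ∷ w) = ω (b ∷ w)

firstPrefix : List Bool → List Bool
firstPrefix w = take 1 w

contractFrom : Bool → List Bool → List Bool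
contractFrom a []      = []
contractFrom a (b ∷ w) = if a xor b then b ∷ contractFrom b w else contractFrom a w

contraction : List Bool → List Bool
contraction []      = []
contraction (a ∷ w) = a ∷ contractFrom a w

TransientVec : ∀ {n} → Vec (List Bool) n → Set
TransientVec x = All Transient x

Δv : ∀ {n} → Vec (List Bool) n → ℕ
Δv V.[]       = 0
Δv (w V.∷ x) = Δ w + Δv x

ProperVec : ∀ {n} → Vec (List Bool) n → Set
ProperVec x = All (λ w → 1 ≤ Δ w) x

charT : List Bool → List Bool
charT w with length w % 2
... | zero  = take 2 w
... | suc _ = take 3 w

charV : ∀ {n} → Vec (List Bool) n → Vec (List Bool) n
charV = V.map charT

IsPrefixOf : List Bool → List Bool → Set
IsPrefixOf p w = ∃ λ s → p ++ s ≡ w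

IsVertex : ∀ {n} → Vec (List Bool) n → Vec (List Bool) n → Set
IsVertex x v = ∀ k → NonEmpty (lookup v k) × IsPrefixOf (lookup v k) (lookup x k)

Arc : ∀ {n} → Vec (List Bool) n → Vec (List Bool) n → Set
Arc {n} v v' = Σ (Fin n) λ k → Σ Bool λ b → v' ≡ (v [ k ]≔ (lookup v k ++ [ b ]))

data PathTo {n} (x : Vec (List Bool) n) : List (Vec (List Bool) n) → Set where
  end  : PathTo x (x ∷ [])
  step : ∀ {v v' vs} → IsVertex x v → Arc v v' → PathTo x (v' ∷ vs) → PathTo x (v ∷ v' ∷ vs)

start : ∀ {n} → Vec (List Bool) n → Vec (List Bool) n
start = V.map firstPrefix

label : ∀ {n} → (Vec Bool n → Bool) → Vec (List Bool) n → Bool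
label f v = f (V.map ω v)

pathWord : ∀ {n} → (Vec Bool n → Bool) → Vec (List Bool) n → List (Vec (List Bool) n) → List Bool
pathWord f x rest = contraction (map (label f) (start x ∷ rest))

IsExtension : ∀ {n} → (Vec Bool n → Bool) → Vec (List Bool) n → List Bool → Set
IsExtension f x w =
  (∃ λ rest → PathTo x (start x ∷ rest) × pathWord f x rest ≡ w)
  × (∀ rest → PathTo x (start x ∷ rest) → length (pathWord f x rest) ≤ length w)

cost : ∀ {n} → Vec (List Bool) n → List Bool → ℤ
cost x w = + Δv x - + Δ w

DependsOn : ∀ {n} → (Vec Bool n → Bool) → Fin n → Set
DependsOn f k = ∃ λ a → f a ≢ f (a [ k ]≔ not (lookup a k))

Convenient : ∀ {n} → (Vec Bool n → Bool) → Set
Convenient {n} f =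
  (∀ (k : Fin n) → DependsOn f k)
  × (∀ (x : Vec (List Bool) n) → TransientVec x → ProperVec x →
       ∀ w w' → IsExtension f x w → IsExtension f (charV x) w' →
       cost x w ≡ cost (charV x) w')

data Op : Set where
  OR XOR : Op

opFold : Op → ∀ {n} → Vec Bool n → Bool
opFold OR  = V.foldr _ _∨_ false
opFold XOR = V.foldr _ _xor_ false

gate : ∀ {n} → Op → Vec Bool n → Bool → Vec Bool n → Bool
gate op c d a = d xor opFold op (V.zipWith _xor_ c a)

-- Every arc of D_f(x) appends one letter, so all paths from the first
-- letters to x have Δ(x) arcs, and the contraction of the labels along a
-- path has length Δ(x) + 1 minus the number of arcs that leave the label
-- unchanged ("stutters").  Hence c_f(x) is the least number of stutters of
-- a path.  Flipping one input of an XOR gate always flips its output, so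
-- the cost is 0.  Call an input of an OR gate high when it differs from its
-- complementation bit; flipping one input flips the output iff all other
-- inputs are low.  If p inputs are high at the start and q at the end,
-- every path stutters at least (p - 1)⁺ + (q - 1)⁺ times and a greedy path
-- attains this.  Both costs depend only on the first and last letters of
-- the components, which the characteristic transient preserves.

module Submission where

open import Data.Bool using (Bool; true; false; not; _xor_; _∨_; _∧_; if_then_else_)
open import Data.Bool.Properties
  using (¬-not; not-¬; ∧-zeroʳ; not-involutive; not-distribˡ-xor; not-distribʳ-xor; xor-same; xor-inverseʳ; ∨-identityʳ; ∨-zeroʳ)
open import Data.Nat using (ℕ; zero; suc; pred; _+_; _∸_; _≤_; _<_; _≥_; _<ᵇ_; _%_; z≤n; s≤s; s≤s⁻¹)
open import Data.Nat.Properties hiding (_≟_)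
open import Data.List using (List; []; _∷_; [_]; _++_; length; map; take)
open import Data.List.Properties using (length-++; length-map; ++-assoc; ++-identityʳ)
open import Data.Vec as V using (Vec; lookup; _[_]≔_)
open import Data.Vec.Properties using (lookup∘update; lookup∘update′; lookup-map; lookup-zipWith; map-[]≔; tabulate∘lookup; tabulate-cong)
import Data.Vec.Relation.Unary.All as All
open import Data.Vec.Relation.Unary.All.Properties using (lookup⁺)
open import Data.Fin using (Fin; _≟_) renaming (zero to fzero; suc to fsuc)
open import Data.Fin.Properties using (any?)
open import Data.Product using (Σ; ∃; _×_; _,_; proj₁; proj₂)
open import Data.Sum using (_⊎_; inj₁; inj₂)
import Data.Integer as ℤ
import Data.Integer.Properties as ℤ
open import Relation.Nullary using (¬_; Dec; yes; no; contradiction)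
open import Relation.Binary.PropositionalEquality hiding ([_])
open import Algebra.Properties.CommutativeMonoid.Sum +-0-commutativeMonoid using (sum; sum-cong-≗; sum-replicate-zero)

open import Defs

≢-≢⇒≡ : ∀ {a b c : Bool} → a ≢ b → b ≢ c → a ≡ c
≢-≢⇒≡ {c = c} a≢b b≢c = trans (¬-not a≢b) (trans (cong not (¬-not b≢c)) (not-involutive c))

ω-++-[] : ∀ (u : List Bool) b → ω (u ++ [ b ]) ≡ b
ω-++-[] []          b = refl
ω-++-[] (_ ∷ [])    b = refl
ω-++-[] (_ ∷ a ∷ u) b = ω-++-[] (a ∷ u) b

Alternating-++⇒ω≢ : ∀ u {b s} → NonEmpty u → Alternating (u ++ b ∷ s) → ω u ≢ b
Alternating-++⇒ω≢ (_ ∷ [])    ne (alt∷ a≢b _) = a≢b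
Alternating-++⇒ω≢ (_ ∷ a ∷ u) ne (alt∷ _ alt) = Alternating-++⇒ω≢ (a ∷ u) ne alt

stutters : Bool → List Bool → ℕ
stutters a []      = 0
stutters a (b ∷ t) = (if a xor b then 0 else 1) + stutters b t

length-contractFrom : ∀ a t → length (contractFrom a t) + stutters a t ≡ length t
length-contractFrom a     []          = refl
length-contractFrom false (false ∷ t) = trans (+-suc _ _) (cong suc (length-contractFrom false t))
length-contractFrom false (true ∷ t)  = cong suc (length-contractFrom true t)
length-contractFrom true  (false ∷ t) = cong suc (length-contractFrom false t)
length-contractFrom true  (true ∷ t)  = trans (+-suc _ _) (cong suc (length-contractFrom true t))

stutters≤length : ∀ a t → stutters a t ≤ length t
stutters≤length a [] = z≤n
stutters≤length a (b ∷ t) with a xor b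
... | true  = m≤n⇒m≤1+n (stutters≤length b t)
... | false = s≤s (stutters≤length b t)

stutters-flip : ∀ {a b} t → b ≡ not a → stutters a (b ∷ t) ≡ stutters b t
stutters-flip {a} t refl rewrite xor-inverseʳ a = refl

stutters-repeat : ∀ {a b} t → b ≡ a → stutters a (b ∷ t) ≡ suc (stutters b t)
stutters-repeat {a} t refl rewrite xor-same a = refl

stutters-∷-≤ : ∀ a b t → stutters a (b ∷ t) ≤ suc (stutters b t)
stutters-∷-≤ a b t with a xor b
... | true  = n≤1+n _
... | false = ≤-refl

-- Words of length at most three are their own characteristic transients,
-- and deleting the third and fourth letters of an alternating word changes
-- neither its characteristic transient nor its ends.
charT-drop₂ : ∀ {a b c d t} → Alternating (a ∷ b ∷ c ∷ d ∷ t) → charT (a ∷ b ∷ c ∷ d ∷ t) ≡ charT (a ∷ b ∷ t)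
charT-drop₂ {t = []}    _ = refl
charT-drop₂ {t = e ∷ t} (alt∷ _ (alt∷ _ (alt∷ c≢d (alt∷ d≢e _)))) with length (e ∷ t) % 2
... | zero  = refl
... | suc _ = cong (λ z → _ ∷ _ ∷ z ∷ []) (≢-≢⇒≡ c≢d d≢e)

Alternating-drop₂ : ∀ {a b c d t} → Alternating (a ∷ b ∷ c ∷ d ∷ t) → Alternating (a ∷ b ∷ t)
Alternating-drop₂ {t = []}    (alt∷ a≢b _) = alt∷ a≢b alt1
Alternating-drop₂ {t = e ∷ t} (alt∷ a≢b (alt∷ b≢c (alt∷ c≢d (alt∷ d≢e alt)))) =
  alt∷ a≢b (alt∷ (λ b≡e → d≢e (trans (sym (≢-≢⇒≡ b≢c c≢d)) b≡e)) alt)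

ω-drop₂ : ∀ {a b c d t} → Alternating (a ∷ b ∷ c ∷ d ∷ t) → ω (a ∷ b ∷ c ∷ d ∷ t) ≡ ω (a ∷ b ∷ t)
ω-drop₂ {t = t} (alt∷ _ (alt∷ b≢c (alt∷ c≢d _))) = cong (λ z → ω (z ∷ t)) (sym (≢-≢⇒≡ b≢c c≢d))

charT-ends : ∀ {w} → Alternating w → take 1 (charT w) ≡ take 1 w × ω (charT w) ≡ ω w
charT-ends {[]}                  _ = refl , refl
charT-ends {_ ∷ []}              _ = refl , refl
charT-ends {_ ∷ _ ∷ []}          _ = refl , refl
charT-ends {_ ∷ _ ∷ _ ∷ []}      _ = refl , refl
charT-ends {a ∷ b ∷ _ ∷ _ ∷ t} alt with charT-ends {a ∷ b ∷ t} (Alternating-drop₂ alt)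
... | first , last = trans (cong (take 1) (charT-drop₂ alt)) first
                   , trans (cong ω (charT-drop₂ alt)) (trans last (sym (ω-drop₂ alt)))

charT-proper : ∀ {w} → Transient w → 1 ≤ Δ w → Transient (charT w) × 1 ≤ Δ (charT w)
charT-proper {_ ∷ _ ∷ []}         t _ = t , s≤s z≤n
charT-proper {_ ∷ _ ∷ _ ∷ []}     t _ = t , s≤s z≤n
charT-proper {a ∷ b ∷ _ ∷ _ ∷ t} (ne , alt) _ =
  subst (λ u → Transient u × 1 ≤ Δ u) (sym (charT-drop₂ alt))
    (charT-proper {a ∷ b ∷ t} (ne , Alternating-drop₂ alt) (s≤s z≤n))

charV-proper : ∀ {n} {x : Vec (List Bool) n} → TransientVec x → ProperVec x →
  TransientVec (charV x) × ProperVec (charV x)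
charV-proper All.[] All.[] = All.[] , All.[]
charV-proper (t All.∷ ts) (p All.∷ ps) with charT-proper t p | charV-proper ts ps
... | t′ , p′ | ts′ , ps′ = t′ All.∷ ts′ , p′ All.∷ ps′

sum-agree : ∀ {n} {f g : Fin n → ℕ} k → (∀ i → i ≢ k → f i ≡ g i) → sum f + g k ≡ sum g + f k
sum-agree {f = f} {g} fzero h = begin
  f fzero + sum (λ i → f (fsuc i)) + g fzero  ≡⟨ cong (λ s → f fzero + s + g fzero) (sum-cong-≗ (λ i → h (fsuc i) λ ())) ⟩
  f fzero + S + g fzero                       ≡⟨ +-comm (f fzero + S) (g fzero) ⟩
  g fzero + (f fzero + S)                     ≡⟨ cong (g fzero +_) (+-comm (f fzero) S) ⟩
  g fzero + (S + f fzero)                     ≡⟨ +-assoc (g fzero) S (f fzero) ⟨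
  g fzero + S + f fzero                       ∎
  where open ≡-Reasoning
        S = sum (λ i → g (fsuc i))
sum-agree {f = f} {g} (fsuc k) h = begin
  f fzero + sum (λ i → f (fsuc i)) + g (fsuc k)    ≡⟨ +-assoc (f fzero) _ _ ⟩
  f fzero + (sum (λ i → f (fsuc i)) + g (fsuc k))  ≡⟨ cong₂ _+_ (h fzero λ ()) (sum-agree k λ i i≢k → h (fsuc i) (λ { refl → i≢k refl })) ⟩
  g fzero + (sum (λ i → g (fsuc i)) + f (fsuc k))  ≡⟨ +-assoc (g fzero) _ _ ⟨
  g fzero + sum (λ i → g (fsuc i)) + f (fsuc k)    ∎
  where open ≡-Reasoning

sum-supported : ∀ {n} (f : Fin n → ℕ) k → (∀ i → i ≢ k → f i ≡ 0) → sum f ≡ f k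
sum-supported {n} f k h = begin
  sum f                   ≡⟨ +-identityʳ (sum f) ⟨
  sum f + 0               ≡⟨ sum-agree {g = λ _ → 0} k h ⟩
  sum {n} (λ _ → 0) + f k ≡⟨ cong (_+ f k) (sum-replicate-zero n) ⟩
  f k                     ∎
  where open ≡-Reasoning

lookup≤sum : ∀ {n} (f : Fin n → ℕ) k → f k ≤ sum f
lookup≤sum f fzero    = m≤m+n _ _
lookup≤sum f (fsuc k) = ≤-trans (lookup≤sum (λ i → f (fsuc i)) k) (m≤n+m _ _)

two-lookups≤sum : ∀ {n} (f : Fin n → ℕ) {i k} → i ≢ k → f i + f k ≤ sum f
two-lookups≤sum f {fzero}  {fzero}  i≢k = contradiction refl i≢k
two-lookups≤sum f {fzero}  {fsuc k} _   = +-monoʳ-≤ (f fzero) (lookup≤sum (λ i → f (fsuc i)) k)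
two-lookups≤sum f {fsuc i} {fzero}  _   =
  ≤-trans (≤-reflexive (+-comm (f (fsuc i)) _)) (+-monoʳ-≤ (f fzero) (lookup≤sum (λ j → f (fsuc j)) i))
two-lookups≤sum f {fsuc i} {fsuc k} i≢k =
  ≤-trans (two-lookups≤sum (λ j → f (fsuc j)) (λ { refl → i≢k refl })) (m≤n+m _ _)

sum≡0⇒ : ∀ {n} (f : Fin n → ℕ) → sum f ≡ 0 → ∀ i → f i ≡ 0
sum≡0⇒ f s≡0 i = n≤0⇒n≡0 (subst (f i ≤_) s≡0 (lookup≤sum f i))

sum-positive : ∀ {n} (f : Fin n → ℕ) → 0 < sum f → ∃ λ i → 0 < f i
sum-positive {zero}  f ()
sum-positive {suc n} f s>0 with f fzero in eq
... | suc _ = fzero , subst (0 <_) (sym eq) (s≤s z≤n)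
... | zero with sum-positive (λ i → f (fsuc i)) s>0
...   | i , fi>0 = fsuc i , fi>0

indicator : Bool → ℕ
indicator b = if b then 1 else 0

indicator≤1 : ∀ b → indicator b ≤ 1
indicator≤1 true  = ≤-refl
indicator≤1 false = z≤n

count : ∀ {n} → (Fin n → Bool) → ℕ
count p = sum (λ i → indicator (p i))

count-agree : ∀ {n} {p q : Fin n → Bool} k → (∀ i → i ≢ k → p i ≡ q i) →
  count p + indicator (q k) ≡ count q + indicator (p k)
count-agree k h = sum-agree k (λ i i≢k → cong indicator (h i i≢k))

count≡0⇒ : ∀ {n} (p : Fin n → Bool) → count p ≡ 0 → ∀ i → p i ≡ false
count≡0⇒ p c≡0 i with p i | sum≡0⇒ (λ j → indicator (p j)) c≡0 i
... | false | _  = refl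
... | true  | ()

count-positive : ∀ {n} (p : Fin n → Bool) → 0 < count p → ∃ λ k → p k ≡ true
count-positive p c>0 with sum-positive (λ j → indicator (p j)) c>0
... | k , pk>0 = k , indicator-positive pk>0
  where
  indicator-positive : ∀ {b} → 0 < indicator b → b ≡ true
  indicator-positive {true} _ = refl

count≤1 : ∀ {n} (p : Fin n → Bool) k → (∀ i → i ≢ k → p i ≡ false) → count p ≤ 1
count≤1 p k h =
  ≤-trans (≤-reflexive (sum-supported _ k (λ i i≢k → cong indicator (h i i≢k)))) (indicator≤1 (p k))

count≡1⇒ : ∀ {n} (p : Fin n → Bool) {k} → count p ≡ 1 → p k ≡ true → ∀ i → i ≢ k → p i ≡ false
count≡1⇒ p {k} c≡1 pk i i≢k with p i in pi
... | false = refl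
... | true  = contradiction 2≤1 λ { (s≤s ()) }
  where
  2≤1 : 2 ≤ 1
  2≤1 = subst₂ (λ a b → indicator a + indicator b ≤ 1) pi pk
          (subst (_ ≤_) c≡1 (two-lookups≤sum (λ j → indicator (p j)) i≢k))

count-false : ∀ {n} (p : Fin n → Bool) → (∀ i → p i ≡ false) → count p ≡ 0
count-false {n} p h = trans (sum-cong-≗ (λ i → cong indicator (h i))) (sum-replicate-zero n)

-- How the two counts of a step of the OR analysis can change: the moving
-- input goes from effective value a to not a and is still active (α) or
-- has reached its final effective value E.
counts-step : ∀ {p p′ q q′} α a E →
  p + indicator (α ∧ not a) ≡ p′ + indicator a →
  q + indicator (α ∧ E) ≡ q′ + indicator E →
  (α ≡ false → E ≡ not a) →
  (p ≤ suc p′ × q ≤ q′) ⊎ (p ≤ p′ × q ≡ suc q′ × α ≡ false × a ≡ false)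
counts-step {p} {p′} {q} {q′} true a E now later _ = inj₁ (p≤ , ≤-reflexive (+-cancelʳ-≡ (indicator E) q q′ later))
  where
  p≤ : p ≤ suc p′
  p≤ = begin
    p                           ≤⟨ m≤m+n p _ ⟩
    p + indicator (not a)       ≡⟨ now ⟩
    p′ + indicator a            ≤⟨ +-monoʳ-≤ p′ (indicator≤1 a) ⟩
    p′ + 1                      ≡⟨ +-comm p′ 1 ⟩
    suc p′                      ∎
    where open ≤-Reasoning
counts-step {p} {p′} {q} {q′} false true E now later final rewrite final refl =
  inj₁ ( ≤-reflexive (trans (sym (+-identityʳ p)) (trans now (+-comm p′ 1)))
       , ≤-reflexive (trans (sym (+-identityʳ q)) (trans later (+-identityʳ q′))) )
counts-step {p} {p′} {q} {q′} false false E now later final rewrite final refl =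
  inj₂ ( ≤-reflexive (trans (sym (+-identityʳ p)) (trans now (+-identityʳ p′)))
       , trans (sym (+-identityʳ q)) (trans later (+-comm q′ 1))
       , refl , refl )

≤-suc-pred : ∀ n → n ≤ suc (pred n)
≤-suc-pred zero    = z≤n
≤-suc-pred (suc n) = ≤-refl

pred+pred-≤ˡ : ∀ {p p′ q q′} → p ≤ suc p′ → q ≤ q′ → pred p + pred q ≤ suc (pred p′ + pred q′)
pred+pred-≤ˡ {p′ = p′} p≤ q≤ = +-mono-≤ (≤-trans (pred-mono-≤ p≤) (≤-suc-pred p′)) (pred-mono-≤ q≤)

pred+pred-≤ʳ : ∀ {p p′ q q′} → p ≤ p′ → q ≤ suc q′ → pred p + pred q ≤ suc (pred p′ + pred q′)
pred+pred-≤ʳ {p′ = p′} {q′ = q′} p≤ q≤ =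
  ≤-trans (+-mono-≤ (pred-mono-≤ p≤) (≤-trans (pred-mono-≤ q≤) (≤-suc-pred q′))) (≤-reflexive (+-suc (pred p′) (pred q′)))

0<ᵇ⇒0< : ∀ {r} → (0 <ᵇ r) ≡ true → 0 < r
0<ᵇ⇒0< {suc _} _ = s≤s z≤n

0<⇒0<ᵇ : ∀ {r} → 0 < r → (0 <ᵇ r) ≡ true
0<⇒0<ᵇ (s≤s _) = refl

∧-true : ∀ {a b} → a ∧ b ≡ true → a ≡ true × b ≡ true
∧-true {true} {true} _ = refl , refl

toggle : ∀ {n} → Fin n → Vec Bool n → Vec Bool n
toggle k a = a [ k ]≔ not (lookup a k)

zipWith-xor-toggle : ∀ {n} (c a : Vec Bool n) k → V.zipWith _xor_ c (toggle k a) ≡ toggle k (V.zipWith _xor_ c a)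
zipWith-xor-toggle (c V.∷ _) (a V.∷ _) fzero    = cong (V._∷ _) (sym (not-distribʳ-xor c a))
zipWith-xor-toggle (_ V.∷ c) (_ V.∷ a) (fsuc k) = cong (_ V.∷_) (zipWith-xor-toggle c a k)

xor-toggle : ∀ {n} k (e : Vec Bool n) → opFold XOR (toggle k e) ≡ not (opFold XOR e)
xor-toggle fzero    (b V.∷ e) = sym (not-distribˡ-xor b _)
xor-toggle (fsuc k) (b V.∷ e) = trans (cong (b xor_) (xor-toggle k e)) (sym (not-distribʳ-xor b _))

or-true : ∀ {n} (e : Vec Bool n) i → lookup e i ≡ true → opFold OR e ≡ true
or-true (_ V.∷ e) fzero    refl = refl
or-true (b V.∷ e) (fsuc i) ei   = trans (cong (b ∨_) (or-true e i ei)) (∨-zeroʳ b)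

or-false : ∀ {n} (e : Vec Bool n) → (∀ i → lookup e i ≡ false) → opFold OR e ≡ false
or-false V.[]      _ = refl
or-false (b V.∷ e) h rewrite h fzero = or-false e (λ i → h (fsuc i))

or-toggle : ∀ {n} k (e : Vec Bool n) → (∀ i → i ≢ k → lookup e i ≡ false) → opFold OR (toggle k e) ≡ not (opFold OR e)
or-toggle fzero (b V.∷ e) h
  rewrite or-false e (λ i → h (fsuc i) λ ()) | ∨-identityʳ b | ∨-identityʳ (not b) = refl
or-toggle (fsuc k) (b V.∷ e) h
  rewrite h fzero (λ ()) = or-toggle k e (λ i i≢k → h (fsuc i) λ { refl → i≢k refl })

module _ {n} (c : Vec Bool n) (d : Bool) (a : Vec Bool n) (k : Fin n) where

  private
    e = V.zipWith _xor_ c a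

    lookup-e : ∀ i → lookup e i ≡ lookup c i xor lookup a i
    lookup-e i = lookup-zipWith _xor_ i c a

    gate-toggle : ∀ op → gate op c d (toggle k a) ≡ d xor opFold op (toggle k e)
    gate-toggle op = cong (λ u → d xor opFold op u) (zipWith-xor-toggle c a k)

  gate-XOR-toggle : gate XOR c d (toggle k a) ≡ not (gate XOR c d a)
  gate-XOR-toggle = trans (gate-toggle XOR) (trans (cong (d xor_) (xor-toggle k e)) (sym (not-distribʳ-xor d _)))

  gate-OR-toggle : (∀ i → i ≢ k → lookup c i xor lookup a i ≡ false) → gate OR c d (toggle k a) ≡ not (gate OR c d a)
  gate-OR-toggle h = trans (gate-toggle OR)
    (trans (cong (d xor_) (or-toggle k e (λ i i≢k → trans (lookup-e i) (h i i≢k)))) (sym (not-distribʳ-xor d _)))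

  gate-OR-toggle-stable : ∀ i → i ≢ k → lookup c i xor lookup a i ≡ true → gate OR c d (toggle k a) ≡ gate OR c d a
  gate-OR-toggle-stable i i≢k ei = trans (gate-toggle OR) (cong (d xor_) (trans
    (or-true (toggle k e) i (trans (lookup∘update′ i≢k e _) (trans (lookup-e i) ei)))
    (sym (or-true e i (trans (lookup-e i) ei)))))

gate-depends : ∀ {n} op (c : Vec Bool n) d k → DependsOn (gate op c d) k
gate-depends op c d k = c , λ same → not-¬ refl (trans same (toggles op))
  where
  toggles : ∀ op → gate op c d (toggle k c) ≡ not (gate op c d c)
  toggles XOR = gate-XOR-toggle c d c k
  toggles OR  = gate-OR-toggle c d c k (λ i _ → xor-same (lookup c i))

-- Paths in D_f(x)

sum-Δ : ∀ {n} (y : Vec (List Bool) n) → sum (λ i → Δ (lookup y i)) ≡ Δv y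
sum-Δ V.[]      = refl
sum-Δ (w V.∷ y) = cong (Δ w +_) (sum-Δ y)

module Digraph {n} (x : Vec (List Bool) n) (tx : TransientVec x) where

  Vertex : Set
  Vertex = Vec (List Bool) n

  transient : ∀ i → Transient (lookup x i)
  transient = lookup⁺ tx

  remaining : Vertex → Fin n → ℕ
  remaining v i = length (lookup x i) ∸ length (lookup v i)

  totalRemaining : Vertex → ℕ
  totalRemaining v = sum (remaining v)

  remaining-prefix : ∀ v i {s} → lookup v i ++ s ≡ lookup x i → remaining v i ≡ length s
  remaining-prefix v i {s} eq = begin
    length (lookup x i) ∸ length (lookup v i)             ≡⟨ cong (λ u → length u ∸ length (lookup v i)) eq ⟨
    length (lookup v i ++ s) ∸ length (lookup v i)        ≡⟨ cong (_∸ length (lookup v i)) (length-++ (lookup v i) {s}) ⟩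
    length (lookup v i) + length s ∸ length (lookup v i)  ≡⟨ m+n∸m≡n (length (lookup v i)) (length s) ⟩
    length s                                              ∎
    where open ≡-Reasoning

  complete-if-finished : ∀ {v i} → IsVertex x v → remaining v i ≡ 0 → lookup v i ≡ lookup x i
  complete-if-finished {v} {i} iv r≡0 with iv i
  ... | _ , []    , eq = trans (sym (++-identityʳ _)) eq
  ... | _ , _ ∷ _ , eq = contradiction (trans (sym (remaining-prefix v i eq)) r≡0) λ ()

  ArcAlong : Fin n → Vertex → Vertex → Set
  ArcAlong k v v′ = Σ Bool λ b → v′ ≡ v [ k ]≔ (lookup v k ++ [ b ])

  record ArcAt (k : Fin n) (v v′ : Vertex) : Set where
    field
      agree               : ∀ i → i ≢ k → lookup v′ i ≡ lookup v i
      ω-toggles           : ω (lookup v′ k) ≡ not (ω (lookup v k))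
      lastLetters-toggle  : V.map ω v′ ≡ toggle k (V.map ω v)
      remaining-decreases : remaining v k ≡ suc (remaining v′ k)

  arcAt : ∀ {k v v′} → IsVertex x v → IsVertex x v′ → ArcAlong k v v′ → ArcAt k v v′
  arcAt {k} {v} iv iv′ (b , refl) = record
    { agree               = λ i i≢k → lookup∘update′ i≢k v _
    ; ω-toggles           = trans (cong ω extended) last
    ; lastLetters-toggle  = trans (map-[]≔ ω v k) (cong (V.map ω v [ k ]≔_) (trans last (cong not (sym (lookup-map k ω v)))))
    ; remaining-decreases = trans (remaining-prefix v k x-split)
                              (cong suc (sym (remaining-prefix (v [ k ]≔ (lookup v k ++ [ b ])) k (proj₂ (proj₂ (iv′ k))))))
    }
    where
    extended : lookup (v [ k ]≔ (lookup v k ++ [ b ])) k ≡ lookup v k ++ [ b ]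
    extended = lookup∘update k v _
    s = proj₁ (proj₂ (iv′ k))
    x-split : lookup v k ++ b ∷ s ≡ lookup x k
    x-split = trans (sym (++-assoc (lookup v k) [ b ] s)) (trans (cong (_++ s) (sym extended)) (proj₂ (proj₂ (iv′ k))))
    last : ω (lookup v k ++ [ b ]) ≡ not (ω (lookup v k))
    last = trans (ω-++-[] (lookup v k) b) (¬-not (≢-sym (Alternating-++⇒ω≢ (lookup v k) (proj₁ (iv k))
             (subst Alternating (sym x-split) (proj₂ (transient k))))))

  successor : ∀ {v k} → IsVertex x v → 0 < remaining v k → Σ _ λ v′ → IsVertex x v′ × ArcAlong k v v′
  successor {v} {k} iv r>0 with iv k
  ... | _  , []    , eq = contradiction (subst (0 <_) (remaining-prefix v k eq) r>0) λ ()
  ... | nonempty-vk , b ∷ s , eq = v [ k ]≔ (lookup v k ++ [ b ]) , extended-vertex , b , refl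
    where
    extended-vertex : IsVertex x (v [ k ]≔ (lookup v k ++ [ b ]))
    extended-vertex i with i ≟ k
    ... | yes refl rewrite lookup∘update i v (lookup v i ++ [ b ]) =
      nonempty nonempty-vk , s , trans (++-assoc (lookup v i) [ b ] s) eq
      where
      nonempty : ∀ {u} → NonEmpty u → NonEmpty (u ++ [ b ])
      nonempty ne = ne
    ... | no i≢k = subst (λ u → NonEmpty u × IsPrefixOf u (lookup x i)) (sym (lookup∘update′ i≢k v _)) (iv i)

  remaining-agree : ∀ {k v v′} → ArcAt k v v′ → ∀ i → i ≢ k → remaining v′ i ≡ remaining v i
  remaining-agree ai i i≢k = cong (λ u → length (lookup x i) ∸ length u) (ArcAt.agree ai i i≢k)

  totalRemaining-arc : ∀ {k v v′} → ArcAt k v v′ → totalRemaining v ≡ suc (totalRemaining v′)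
  totalRemaining-arc {k} {v} {v′} ai = +-cancelʳ-≡ (remaining v′ k) _ _ (begin
    totalRemaining v + remaining v′ k         ≡⟨ sum-agree k (λ i i≢k → sym (remaining-agree ai i i≢k)) ⟩
    totalRemaining v′ + remaining v k         ≡⟨ cong (totalRemaining v′ +_) remaining-decreases ⟩
    totalRemaining v′ + suc (remaining v′ k)  ≡⟨ +-suc _ _ ⟩
    suc (totalRemaining v′) + remaining v′ k  ∎)
    where open ≡-Reasoning
          open ArcAt ai

  totalRemaining-x : totalRemaining x ≡ 0
  totalRemaining-x = trans (sum-cong-≗ (λ i → n∸n≡0 (length (lookup x i)))) (sum-replicate-zero n)

  x-vertex : IsVertex x x
  x-vertex i = proj₁ (transient i) , [] , ++-identityʳ _

  head-vertex : ∀ {v rest} → PathTo x (v ∷ rest) → IsVertex x v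
  head-vertex end          = x-vertex
  head-vertex (step iv _ _) = iv

  length-path : ∀ {v rest} → PathTo x (v ∷ rest) → length rest ≡ totalRemaining v
  length-path end                     = sym totalRemaining-x
  length-path (step iv (_ , along) p) =
    trans (cong suc (length-path p)) (sym (totalRemaining-arc (arcAt iv (head-vertex p) along)))

  finished⇒x : ∀ {v} → IsVertex x v → totalRemaining v ≡ 0 → v ≡ x
  finished⇒x {v} iv r≡0 = begin
    v                           ≡⟨ tabulate∘lookup v ⟨
    V.tabulate (lookup v)       ≡⟨ tabulate-cong (λ i → complete-if-finished {v} {i} iv (sum≡0⇒ (remaining v) r≡0 i)) ⟩
    V.tabulate (lookup x)       ≡⟨ tabulate∘lookup x ⟩
    x                           ∎
    where open ≡-Reasoning

  path-from : ∀ N {v} → totalRemaining v ≡ N → IsVertex x v → ∃ λ rest → PathTo x (v ∷ rest)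
  path-from zero    r≡0 iv = [] , subst (λ u → PathTo x (u ∷ [])) (sym (finished⇒x iv r≡0)) end
  path-from (suc N) {v} r≡N iv with sum-positive (remaining v) (subst (0 <_) (sym r≡N) (s≤s z≤n))
  ... | k , rk>0 with successor iv rk>0
  ...   | v′ , iv′ , along with path-from N (suc-injective (trans (sym (totalRemaining-arc (arcAt iv iv′ along))) r≡N)) iv′
  ...     | rest , p = v′ ∷ rest , step iv (k , along) p

  start-vertex : IsVertex x (start x)
  start-vertex i rewrite lookup-map i firstPrefix x = first-letter (proj₁ (transient i))
    where
    first-letter : ∀ {w} → NonEmpty w → NonEmpty (take 1 w) × IsPrefixOf (take 1 w) w
    first-letter (ne {w = w}) = ne , w , refl

  remaining-start : ∀ i → remaining (start x) i ≡ Δ (lookup x i)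
  remaining-start i rewrite lookup-map i firstPrefix x = Δ-nonempty (proj₁ (transient i))
    where
    Δ-nonempty : ∀ {w} → NonEmpty w → length w ∸ length (take 1 w) ≡ Δ w
    Δ-nonempty ne = refl

  totalRemaining-start : totalRemaining (start x) ≡ Δv x
  totalRemaining-start = trans (sum-cong-≗ remaining-start) (sum-Δ x)

  module Stutters (f : Vec Bool n → Bool) where

    stuttersFrom : Vertex → List Vertex → ℕ
    stuttersFrom v rest = stutters (label f v) (map (label f) rest)

    pathWord-length : ∀ {rest} → PathTo x (start x ∷ rest) →
      length (pathWord f x rest) + stuttersFrom (start x) rest ≡ suc (Δv x)
    pathWord-length {rest} p = cong suc (begin
      length (contractFrom (label f (start x)) labels) + stutters (label f (start x)) labels  ≡⟨ length-contractFrom _ labels ⟩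
      length labels                                                                      ≡⟨ length-map (label f) rest ⟩
      length rest                                                                        ≡⟨ length-path p ⟩
      totalRemaining (start x)                                                           ≡⟨ totalRemaining-start ⟩
      Δv x                                                                               ∎)
      where open ≡-Reasoning
            labels = map (label f) rest

    extension-cost : ∀ K {w} →
      (∀ rest → PathTo x (start x ∷ rest) → K ≤ stuttersFrom (start x) rest) →
      (∃ λ rest → PathTo x (start x ∷ rest) × stuttersFrom (start x) rest ≤ K) →
      IsExtension f x w → Δ w + K ≡ Δv x
    extension-cost K lower (rc , pc , cheap) ((rw , pw , refl) , longest) =
      suc-injective (trans (cong (λ s → suc (Δ w + s)) (sym Sw≡K)) (pathWord-length pw))
      where
      w = pathWord f x rw
      Sw≤Sc : stuttersFrom (start x) rw ≤ stuttersFrom (start x) rc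
      Sw≤Sc = +-cancelˡ-≤ (length w) _ _ (begin
        length w + stuttersFrom (start x) rw                  ≡⟨ pathWord-length pw ⟩
        suc (Δv x)                                            ≡⟨ pathWord-length pc ⟨
        length (pathWord f x rc) + stuttersFrom (start x) rc  ≤⟨ +-monoˡ-≤ _ (longest rc pc) ⟩
        length w + stuttersFrom (start x) rc                  ∎)
        where open ≤-Reasoning hiding (start)
      Sw≡K : stuttersFrom (start x) rw ≡ K
      Sw≡K = ≤-antisym (≤-trans Sw≤Sc cheap) (lower rw pw)

-- XOR gates

module XorGate {n} (c : Vec Bool n) (d : Bool) (x : Vec (List Bool) n) (tx : TransientVec x) where
  open Digraph x tx
  open Stutters (gate XOR c d)

  never-stutters : ∀ {v rest} → PathTo x (v ∷ rest) → stuttersFrom v rest ≡ 0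
  never-stutters end = refl
  never-stutters (step {v} {v′} {vs} iv (k , along) p) = trans (stutters-flip (map (label (gate XOR c d)) vs) flips) (never-stutters p)
    where
    flips : gate XOR c d (V.map ω v′) ≡ not (gate XOR c d (V.map ω v))
    flips = trans (cong (gate XOR c d) (ArcAt.lastLetters-toggle (arcAt iv (head-vertex p) along)))
                  (gate-XOR-toggle c d (V.map ω v) k)

  xor-cost : ∀ {w} → IsExtension (gate XOR c d) x w → Δ w + 0 ≡ Δv x
  xor-cost ext@((rw , pw , _) , _) = extension-cost 0 (λ _ _ → z≤n) (rw , pw , ≤-reflexive (never-stutters pw)) ext

-- OR gates

orCost : ∀ {n} → Vec Bool n → Vec (List Bool) n → ℕ
orCost c x = pred (count λ i → lookup c i xor ω (take 1 (lookup x i)))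
           + pred (count λ i → lookup c i xor ω (lookup x i))

module OrGate {n} (c : Vec Bool n) (d : Bool) (x : Vec (List Bool) n) (tx : TransientVec x) where
  open Digraph x tx
  open Stutters (gate OR c d)

  effective : Vertex → Fin n → Bool
  effective v i = lookup c i xor ω (lookup v i)

  active : Vertex → Fin n → Bool
  active v i = 0 <ᵇ remaining v i

  highNow highAtEnd : Vertex → ℕ
  highNow   v = count λ i → active v i ∧ effective v i
  highAtEnd v = count λ i → active v i ∧ effective x i

  orCostFrom : Vertex → ℕ
  orCostFrom v = pred (highNow v) + pred (highAtEnd v)

  -- A finished input stuck at effective value 1 keeps the OR output constant.
  Stuck Unstuck : Vertex → Set
  Stuck   v = ∃ λ j → remaining v j ≡ 0 × effective v j ≡ true
  Unstuck v = ∀ j → remaining v j ≡ 0 → effective v j ≡ false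

  output : Vertex → Bool
  output = label (gate OR c d)

  CheapPath : Vertex → ℕ → Set
  CheapPath v B = ∃ λ rest → PathTo x (v ∷ rest) × stuttersFrom v rest ≤ B

  inactive-x : ∀ i → active x i ≡ false
  inactive-x i = cong (0 <ᵇ_) (n∸n≡0 (length (lookup x i)))

  highAtEnd-x : highAtEnd x ≡ 0
  highAtEnd-x = count-false _ (λ i → cong (_∧ effective x i) (inactive-x i))

  orCostFrom-x : orCostFrom x ≡ 0
  orCostFrom-x = cong₂ (λ p q → pred p + pred q) highAtEnd-x highAtEnd-x

  inactive⇒finished : ∀ {v i} → active v i ≡ false → remaining v i ≡ 0
  inactive⇒finished {v} {i} inactive with remaining v i
  ... | zero = refl

  ineffective-if : ∀ {v} → Unstuck v → ∀ i → active v i ∧ effective v i ≡ false → effective v i ≡ false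
  ineffective-if {v} u i low with remaining v i in r
  ... | zero  = u i r
  ... | suc _ = low

  module _ {k v v′} (ai : ArcAt k v v′) where
    open ArcAt ai

    effective-arc : effective v′ k ≡ not (effective v k)
    effective-arc = trans (cong (lookup c k xor_) ω-toggles) (sym (not-distribʳ-xor (lookup c k) (ω (lookup v k))))

    effective-agree : ∀ i → i ≢ k → effective v′ i ≡ effective v i
    effective-agree i i≢k = cong (λ w → lookup c i xor ω w) (agree i i≢k)

    active-source : active v k ≡ true
    active-source = cong (0 <ᵇ_) remaining-decreases

    active-agree : ∀ i → i ≢ k → active v′ i ≡ active v i
    active-agree i i≢k = cong (0 <ᵇ_) (remaining-agree ai i i≢k)

    highNow-arc : highNow v + indicator (active v′ k ∧ not (effective v k)) ≡ highNow v′ + indicator (effective v k)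
    highNow-arc = begin
      highNow v + indicator (active v′ k ∧ not (effective v k))  ≡⟨ cong (λ e → highNow v + indicator (active v′ k ∧ e)) effective-arc ⟨
      highNow v + indicator (active v′ k ∧ effective v′ k)       ≡⟨ count-agree k (λ i i≢k → sym (cong₂ _∧_ (active-agree i i≢k) (effective-agree i i≢k))) ⟩
      highNow v′ + indicator (active v k ∧ effective v k)        ≡⟨ cong (λ b → highNow v′ + indicator (b ∧ effective v k)) active-source ⟩
      highNow v′ + indicator (effective v k)                     ∎
      where open ≡-Reasoning

    highAtEnd-arc : highAtEnd v + indicator (active v′ k ∧ effective x k) ≡ highAtEnd v′ + indicator (effective x k)
    highAtEnd-arc = trans (count-agree k (λ i i≢k → sym (cong (_∧ effective x i) (active-agree i i≢k))))
                          (cong (λ b → highAtEnd v′ + indicator (b ∧ effective x k)) active-source)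

    highAtEnd-nonincreasing : highAtEnd v′ ≤ highAtEnd v
    highAtEnd-nonincreasing = +-cancelʳ-≤ (indicator (effective x k)) _ _
      (≤-trans (≤-reflexive (sym highAtEnd-arc)) (+-monoʳ-≤ (highAtEnd v) (indicator-∧ (active v′ k))))
      where
      indicator-∧ : ∀ a {b} → indicator (a ∧ b) ≤ indicator b
      indicator-∧ true  = ≤-refl
      indicator-∧ false = z≤n

    unstuck-arc : Unstuck v → (remaining v′ k ≡ 0 → effective v′ k ≡ false) → Unstuck v′
    unstuck-arc u at-k j r≡0 with j ≟ k
    ... | yes refl = at-k r≡0
    ... | no j≢k   = trans (effective-agree j j≢k) (u j (trans (sym (remaining-agree ai j j≢k)) r≡0))

    output-flips : (∀ i → i ≢ k → effective v i ≡ false) → output v′ ≡ not (output v)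
    output-flips h = trans (cong (gate OR c d) lastLetters-toggle)
      (gate-OR-toggle c d (V.map ω v) k (λ i i≢k → trans (cong (lookup c i xor_) (lookup-map i ω v)) (h i i≢k)))

    output-stable : ∀ i → i ≢ k → effective v i ≡ true → output v′ ≡ output v
    output-stable i i≢k ei = trans (cong (gate OR c d) lastLetters-toggle)
      (gate-OR-toggle-stable c d (V.map ω v) k i i≢k (trans (cong (lookup c i xor_) (lookup-map i ω v)) ei))

    flip⇒others-ineffective : output v′ ≢ output v → ∀ i → i ≢ k → effective v i ≡ false
    flip⇒others-ineffective flip i i≢k with effective v i in ei
    ... | false = refl
    ... | true  = contradiction (output-stable i i≢k ei) flip

    module _ (iv′ : IsVertex x v′) where

      final-effective : remaining v′ k ≡ 0 → effective x k ≡ not (effective v k)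
      final-effective r≡0 = trans (cong (λ w → lookup c k xor ω w) (sym (complete-if-finished {v′} iv′ r≡0))) effective-arc

      arc-counts : (highNow v ≤ suc (highNow v′) × highAtEnd v ≤ highAtEnd v′)
                 ⊎ (highNow v ≤ highNow v′ × highAtEnd v ≡ suc (highAtEnd v′) × Stuck v′)
      arc-counts with counts-step (active v′ k) (effective v k) (effective x k) highNow-arc highAtEnd-arc
                        (λ inactive → final-effective (inactive⇒finished {v′} {k} inactive))
      ... | inj₁ counts = inj₁ counts
      ... | inj₂ (p≤ , q≡ , inactive , low) =
        inj₂ (p≤ , q≡ , k , inactive⇒finished {v′} {k} inactive , trans effective-arc (cong not low))

  stuck-lower-bound : ∀ {v rest} → Stuck v → PathTo x (v ∷ rest) → highAtEnd v ≤ stuttersFrom v rest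
  stuck-lower-bound _ end = ≤-reflexive highAtEnd-x
  stuck-lower-bound (j , rj≡0 , ej) (step {v} {v′} {vs} iv (k , along) p) = begin
    highAtEnd v                  ≤⟨ highAtEnd≤ (arc-counts ai iv′) ⟩
    suc (highAtEnd v′)           ≤⟨ s≤s (stuck-lower-bound stuck′ p) ⟩
    suc (stuttersFrom v′ vs)     ≡⟨ stutters-repeat (map output vs) (output-stable ai j j≢k ej) ⟨
    stuttersFrom v (v′ ∷ vs)     ∎
    where
    open ≤-Reasoning hiding (start)
    iv′ = head-vertex p
    ai = arcAt iv iv′ along
    j≢k : j ≢ k
    j≢k refl = contradiction (trans (sym rj≡0) (ArcAt.remaining-decreases ai)) λ ()
    stuck′ : Stuck v′
    stuck′ = j , trans (remaining-agree ai j j≢k) rj≡0 , trans (effective-agree ai j j≢k) ej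
    highAtEnd≤ : _ → highAtEnd v ≤ suc (highAtEnd v′)
    highAtEnd≤ (inj₁ (_ , q≤))     = m≤n⇒m≤1+n q≤
    highAtEnd≤ (inj₂ (_ , q≡ , _)) = ≤-reflexive q≡

  lower-bound : ∀ {v rest} → PathTo x (v ∷ rest) → orCostFrom v ≤ stuttersFrom v rest
  lower-bound end = ≤-reflexive orCostFrom-x
  lower-bound (step {v} {v′} {vs} iv (k , along) p) = by-output (output v′ Data.Bool.≟ output v)
    where
    open ≤-Reasoning hiding (start)
    iv′ = head-vertex p
    ai = arcAt iv iv′ along
    by-output : Dec (output v′ ≡ output v) → orCostFrom v ≤ stuttersFrom v (v′ ∷ vs)
    by-output (yes same) = begin
      orCostFrom v              ≤⟨ repeat-bound (arc-counts ai iv′) ⟩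
      suc (orCostFrom v′)       ≤⟨ s≤s (lower-bound p) ⟩
      suc (stuttersFrom v′ vs)  ≡⟨ stutters-repeat (map output vs) same ⟨
      stuttersFrom v (v′ ∷ vs)  ∎
      where
      repeat-bound : _ → orCostFrom v ≤ suc (orCostFrom v′)
      repeat-bound (inj₁ (p≤ , q≤))     = pred+pred-≤ˡ p≤ q≤
      repeat-bound (inj₂ (p≤ , q≡ , _)) = pred+pred-≤ʳ p≤ (≤-reflexive q≡)
    by-output (no flip) = begin
      pred (highNow v) + pred (highAtEnd v)  ≤⟨ +-monoˡ-≤ (pred (highAtEnd v)) (pred-mono-≤ highNow≤1) ⟩
      pred (highAtEnd v)                     ≤⟨ flip-bound (arc-counts ai iv′) ⟩
      stuttersFrom v′ vs                     ≡⟨ stutters-flip (map output vs) (¬-not flip) ⟨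
      stuttersFrom v (v′ ∷ vs)               ∎
      where
      highNow≤1 : highNow v ≤ 1
      highNow≤1 = count≤1 _ k (λ i i≢k →
        trans (cong (active v i ∧_) (flip⇒others-ineffective ai flip i i≢k)) (∧-zeroʳ (active v i)))
      flip-bound : _ → pred (highAtEnd v) ≤ stuttersFrom v′ vs
      flip-bound (inj₁ (_ , q≤))          = ≤-trans (pred-mono-≤ q≤) (≤-trans (m≤n+m _ _) (lower-bound p))
      flip-bound (inj₂ (_ , q≡ , stuck′)) = ≤-trans (≤-reflexive (cong pred q≡)) (stuck-lower-bound stuck′ p)

  weaken : ∀ {v B B′} → B ≤ B′ → CheapPath v B → CheapPath v B′
  weaken B≤B′ (rest , p , S≤B) = rest , p , ≤-trans S≤B B≤B′

  prepend : ∀ {k v v′ B} → IsVertex x v → ArcAlong k v v′ → CheapPath v′ B → CheapPath v (suc B)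
  prepend {v = v} {v′} iv along (rest , p , S≤B) =
    v′ ∷ rest , step iv (_ , along) p , ≤-trans (stutters-∷-≤ (output v) (output v′) (map output rest)) (s≤s S≤B)

  prepend-flip : ∀ {k v v′ B} → IsVertex x v → ArcAlong k v v′ → output v′ ≡ not (output v) →
    CheapPath v′ B → CheapPath v B
  prepend-flip {B = B} iv along flips (rest , p , S≤B) =
    _ ∷ rest , step iv (_ , along) p , subst (_≤ B) (sym (stutters-flip (map output rest) flips)) S≤B

  final-effective-one-left : ∀ {v i} → IsVertex x v → remaining v i ≡ 1 → effective x i ≡ not (effective v i)
  final-effective-one-left {v} {i} iv r≡1 with successor {v} {i} iv (subst (0 <_) (sym r≡1) (s≤s z≤n))
  ... | v′ , iv′ , along = final-effective ai iv′ (suc-injective (trans (sym (ArcAt.remaining-decreases ai)) r≡1))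
    where ai = arcAt iv iv′ along

  UpperBound : ℕ → Set
  UpperBound N = ∀ {v} → totalRemaining v ≡ N → IsVertex x v → Unstuck v → CheapPath v (orCostFrom v)

  -- Lower one input that is effectively high: this stutters at most once
  -- and lowers highNow, and it flips the output if that input was the only one.
  via-high-input : ∀ {N v m} → highNow v ≡ suc m → totalRemaining v ≡ suc N → IsVertex x v → Unstuck v →
    UpperBound N → CheapPath v (orCostFrom v)
  via-high-input {N} {v} {m} p≡ r≡ iv u ih with count-positive _ (subst (0 <_) (sym p≡) (s≤s z≤n))
  ... | k , high with ∧-true high
  ... | act , eff with successor iv (0<ᵇ⇒0< act)
  ... | v′ , iv′ , along = from-high m p≡ p′≡
    where
    ai = arcAt iv iv′ along
    eff′ : effective v′ k ≡ false
    eff′ = trans (effective-arc ai) (cong not eff)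
    rest-cheap : CheapPath v′ (orCostFrom v′)
    rest-cheap = ih (suc-injective (trans (sym (totalRemaining-arc ai)) r≡)) iv′ (unstuck-arc ai u (λ _ → eff′))
    p′≡ : highNow v′ ≡ m
    p′≡ = suc-injective (begin
      suc (highNow v′)                                          ≡⟨ +-comm 1 (highNow v′) ⟩
      highNow v′ + indicator true                               ≡⟨ cong (λ b → highNow v′ + indicator b) eff ⟨
      highNow v′ + indicator (effective v k)                    ≡⟨ highNow-arc ai ⟨
      highNow v + indicator (active v′ k ∧ not (effective v k)) ≡⟨ cong (λ b → highNow v + indicator (active v′ k ∧ not b)) eff ⟩
      highNow v + indicator (active v′ k ∧ false)               ≡⟨ cong (λ b → highNow v + indicator b) (∧-zeroʳ (active v′ k)) ⟩
      highNow v + 0                                             ≡⟨ +-identityʳ _ ⟩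
      highNow v                                                 ≡⟨ p≡ ⟩
      suc m                                                     ∎)
      where open ≡-Reasoning
    q′≤ : pred (highAtEnd v′) ≤ pred (highAtEnd v)
    q′≤ = pred-mono-≤ (highAtEnd-nonincreasing ai)
    from-high : ∀ m → highNow v ≡ suc m → highNow v′ ≡ m → CheapPath v (orCostFrom v)
    from-high (suc m) p≡ p′≡ = weaken bound (prepend iv along rest-cheap)
      where
      bound : suc (orCostFrom v′) ≤ orCostFrom v
      bound = subst₂ (λ a b → suc (pred a + pred (highAtEnd v′)) ≤ pred b + pred (highAtEnd v))
                (sym p′≡) (sym p≡) (s≤s (+-monoʳ-≤ m q′≤))
    from-high zero p≡ p′≡ = weaken bound (prepend-flip iv along (output-flips ai others) rest-cheap)
      where
      others : ∀ i → i ≢ k → effective v i ≡ false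
      others i i≢k = ineffective-if {v} u i (count≡1⇒ _ p≡ high i i≢k)
      bound : orCostFrom v′ ≤ orCostFrom v
      bound = subst₂ (λ a b → pred a + pred (highAtEnd v′) ≤ pred b + pred (highAtEnd v)) (sym p′≡) (sym p≡) q′≤

  all-ineffective : ∀ {v} → highNow v ≡ 0 → Unstuck v → ∀ i → effective v i ≡ false
  all-ineffective {v} p≡0 u i = ineffective-if {v} u i (count≡0⇒ _ p≡0 i)

  -- With every input effectively low, advancing an input with at least two
  -- letters left flips the output and leaves highAtEnd unchanged.
  via-long-input : ∀ {N v k} → highNow v ≡ 0 → totalRemaining v ≡ suc N → IsVertex x v → Unstuck v →
    2 ≤ remaining v k → UpperBound N → CheapPath v (orCostFrom v)
  via-long-input {N} {v} {k} p≡0 r≡ iv u long ih with successor {v} {k} iv (≤-trans (s≤s z≤n) long)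
  ... | v′ , iv′ , along = weaken bound (prepend-flip iv along (output-flips ai (λ i _ → low i)) rest-cheap)
    where
    ai = arcAt iv iv′ along
    low = all-ineffective {v} p≡0 u
    still-active : 0 < remaining v′ k
    still-active = s≤s⁻¹ (subst (2 ≤_) (ArcAt.remaining-decreases ai) long)
    act′ : active v′ k ≡ true
    act′ = 0<⇒0<ᵇ still-active
    rest-cheap : CheapPath v′ (orCostFrom v′)
    rest-cheap = ih (suc-injective (trans (sym (totalRemaining-arc ai)) r≡)) iv′
      (unstuck-arc ai u (λ r≡0 → contradiction (subst (0 <_) r≡0 still-active) λ ()))
    p′≡1 : highNow v′ ≡ 1
    p′≡1 = sym (begin
      1                                                          ≡⟨⟩
      0 + indicator (true ∧ not false)                           ≡⟨ cong₂ (λ p b → p + indicator (b ∧ not false)) p≡0 act′ ⟨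
      highNow v + indicator (active v′ k ∧ not false)            ≡⟨ cong (λ e → highNow v + indicator (active v′ k ∧ not e)) (low k) ⟨
      highNow v + indicator (active v′ k ∧ not (effective v k))  ≡⟨ highNow-arc ai ⟩
      highNow v′ + indicator (effective v k)                     ≡⟨ cong (λ e → highNow v′ + indicator e) (low k) ⟩
      highNow v′ + 0                                             ≡⟨ +-identityʳ _ ⟩
      highNow v′                                                 ∎)
      where open ≡-Reasoning
    q′≡ : highAtEnd v′ ≡ highAtEnd v
    q′≡ = sym (+-cancelʳ-≡ (indicator (effective x k)) _ _
            (trans (cong (λ b → highAtEnd v + indicator (b ∧ effective x k)) (sym act′)) (highAtEnd-arc ai)))
    bound : orCostFrom v′ ≤ orCostFrom v
    bound = ≤-reflexive (cong₂ _+_ (trans (cong pred p′≡1) (cong pred (sym p≡0))) (cong pred q′≡))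

  -- If every input is effectively low with at most one letter left, each
  -- active input ends high, so highAtEnd counts all remaining letters; the
  -- first step flips the output and the rest may stutter throughout.
  via-short-inputs : ∀ {N v} → highNow v ≡ 0 → totalRemaining v ≡ suc N → IsVertex x v → Unstuck v →
    (∀ k → ¬ 2 ≤ remaining v k) → CheapPath v (orCostFrom v)
  via-short-inputs {N} {v} p≡0 r≡ iv u short with sum-positive (remaining v) (subst (0 <_) (sym r≡) (s≤s z≤n))
  ... | k , rk>0 with successor iv rk>0
  ... | v′ , iv′ , along = weaken bound (prepend-flip iv along (output-flips ai (λ i _ → low i)) rest-cheap)
    where
    ai = arcAt iv iv′ along
    low = all-ineffective {v} p≡0 u
    r′≡N : totalRemaining v′ ≡ N
    r′≡N = suc-injective (trans (sym (totalRemaining-arc ai)) r≡)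
    rest-cheap : CheapPath v′ N
    rest-cheap with path-from N r′≡N iv′
    ... | rest , p = rest , p , ≤-trans (stutters≤length _ (map output rest))
                                  (≤-reflexive (trans (length-map output rest) (trans (length-path p) r′≡N)))
    high-at-end : ∀ i → indicator (active v i ∧ effective x i) ≡ remaining v i
    high-at-end i with remaining v i in r
    ... | zero          = refl
    ... | suc zero      = cong indicator (trans (final-effective-one-left {v} iv r) (cong not (low i)))
    ... | suc (suc _)   = contradiction (s≤s (s≤s z≤n)) (subst (λ m → ¬ 2 ≤ m) r (short i))
    bound : N ≤ orCostFrom v
    bound = ≤-reflexive (sym (cong₂ (λ a b → pred a + pred b) p≡0 (trans (sum-cong-≗ high-at-end) r≡)))

  upper-bound : ∀ N → UpperBound N
  upper-bound zero    r≡0 iv _ = [] , subst (λ w → PathTo x (w ∷ [])) (sym (finished⇒x iv r≡0)) end , z≤n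
  upper-bound (suc N) {v} r≡ iv u = by-highNow (highNow v) refl
    where
    by-highNow : ∀ h → highNow v ≡ h → CheapPath v (orCostFrom v)
    by-highNow (suc m) p≡ = via-high-input p≡ r≡ iv u (upper-bound N)
    by-highNow zero    p≡ with any? (λ k → 2 ≤? remaining v k)
    ... | yes (k , long) = via-long-input p≡ r≡ iv u long (upper-bound N)
    ... | no ¬long       = via-short-inputs p≡ r≡ iv u (λ k long → ¬long (k , long))

  active-start : ProperVec x → ∀ i → active (start x) i ≡ true
  active-start px i = 0<⇒0<ᵇ (subst (0 <_) (sym (remaining-start i)) (lookup⁺ px i))

  unstuck-start : ProperVec x → Unstuck (start x)
  unstuck-start px j r≡0 = contradiction (trans (sym (active-start px j)) (cong (0 <ᵇ_) r≡0)) λ ()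

  orCostFrom-start : ProperVec x → orCostFrom (start x) ≡ orCost c x
  orCostFrom-start px = cong₂ (λ p q → pred p + pred q) (sum-cong-≗ now) (sum-cong-≗ at-end)
    where
    now : ∀ i → indicator (active (start x) i ∧ effective (start x) i) ≡ indicator (lookup c i xor ω (take 1 (lookup x i)))
    now i = cong indicator (cong₂ _∧_ (active-start px i) (cong (λ w → lookup c i xor ω w) (lookup-map i firstPrefix x)))
    at-end : ∀ i → indicator (active (start x) i ∧ effective x i) ≡ indicator (effective x i)
    at-end i = cong (λ b → indicator (b ∧ effective x i)) (active-start px i)

  or-cost : ProperVec x → ∀ {w} → IsExtension (gate OR c d) x w → Δ w + orCost c x ≡ Δv x
  or-cost px {w} ext = subst (λ K → Δ w + K ≡ Δv x) (orCostFrom-start px)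
    (extension-cost (orCostFrom (start x)) (λ _ → lower-bound)
      (upper-bound _ refl start-vertex (unstuck-start px)) ext)

gateCost : ∀ {n} → Op → Vec Bool n → Vec (List Bool) n → ℕ
gateCost XOR c x = 0
gateCost OR  c x = orCost c x

gate-extension-cost : ∀ {n} op (c : Vec Bool n) d {x w} → TransientVec x → ProperVec x →
  IsExtension (gate op c d) x w → Δ w + gateCost op c x ≡ Δv x
gate-extension-cost XOR c d tx _  = XorGate.xor-cost c d _ tx
gate-extension-cost OR  c d tx px = OrGate.or-cost c d _ tx px

gateCost-charV : ∀ {n} op (c : Vec Bool n) {x} → TransientVec x → gateCost op c (charV x) ≡ gateCost op c x
gateCost-charV XOR c    tx = refl
gateCost-charV OR  c {x} tx = cong₂ (λ p q → pred p + pred q) (sum-cong-≗ first) (sum-cong-≗ last)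
  where
  ends : ∀ i → take 1 (charT (lookup x i)) ≡ take 1 (lookup x i) × ω (charT (lookup x i)) ≡ ω (lookup x i)
  ends i = charT-ends (proj₂ (lookup⁺ tx i))
  ends-charV : ∀ f i → lookup c i xor f (lookup (charV x) i) ≡ lookup c i xor f (charT (lookup x i))
  ends-charV f i = cong (λ w → lookup c i xor f w) (lookup-map i charT x)
  first : ∀ i → indicator (lookup c i xor ω (take 1 (lookup (charV x) i))) ≡ indicator (lookup c i xor ω (take 1 (lookup x i)))
  first i = cong indicator (trans (ends-charV (λ w → ω (take 1 w)) i) (cong (λ w → lookup c i xor ω w) (proj₁ (ends i))))
  last : ∀ i → indicator (lookup c i xor ω (lookup (charV x) i)) ≡ indicator (lookup c i xor ω (lookup x i))
  last i = cong indicator (trans (ends-charV ω i) (cong (lookup c i xor_) (proj₂ (ends i))))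

cost≡ : ∀ {n} (x : Vec (List Bool) n) w K → Δ w + K ≡ Δv x → cost x w ≡ ℤ.+ K
cost≡ x w K eq rewrite sym eq =
  trans (ℤ.m-n≡m⊖n (Δ w + K) (Δ w)) (trans (ℤ.⊖-≥ (m≤m+n (Δ w) K)) (cong ℤ.+_ (m+n∸m≡n (Δ w) K)))

corollary1 : ∀ (n : ℕ) → n ≥ 1 → (op : Op) (c : Vec Bool n) (d : Bool) →
    Convenient (gate op c d)
corollary1 n _ op c d = gate-depends op c d , convenient
  where
  convenient : ∀ x → TransientVec x → ProperVec x → ∀ w w′ →
    IsExtension (gate op c d) x w → IsExtension (gate op c d) (charV x) w′ → cost x w ≡ cost (charV x) w′
  convenient x tx px w w′ ext ext′ with charV-proper tx px
  ... | tx′ , px′ = begin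
    cost x w                       ≡⟨ cost≡ x w _ (gate-extension-cost op c d tx px ext) ⟩
    ℤ.+ gateCost op c x            ≡⟨ cong ℤ.+_ (gateCost-charV op c tx) ⟨
    ℤ.+ gateCost op c (charV x)    ≡⟨ cost≡ (charV x) w′ _ (gate-extension-cost op c d tx′ px′ ext′) ⟨
    cost (charV x) w′              ∎
    where open ≡-Reasoning
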